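{- For every $(\lambda^{(1)}|\cdots|\lambda^{(r)})\in\mathrm{Par}^r$, $K^{(\lambda^{(1)}|\cdots|\lambda^{(r)})}_{(\lambda^{(1)}|\cdots|\lambda^{(r)})}=1$.
   Context: Key polynomials $\mathcal{K}_\alpha$: unique polynomials with $\mathcal{K}_\alpha=x^\alpha$ if $\alpha$ weakly decreasing and $\mathcal{K}_{s_i\alpha}=\xi_i\mathcal{K}_\alpha$ whenever $\alpha_i>\alpha_{i+1}$, $\xi_if=\frac{x_if-x_{i+1}s_if}{x_i-x_{i+1}}$. $\mathrm{rev}(\lambda)=(\lambda_{\ell(\lambda)},\dots,\lambda_1)$, $*$ concatenation, $0^m$ $m$ zeros. The multi-symmetric Schur function $\mathcal{S}_{(\lambda)}(X_1|\cdots|X_r)\in\Lambda(X_1)\otimes\cdots\otimes\Lambda(X_r)$ is the coefficientwise limit as $n_j\to\infty$ of $\mathcal{K}_\gamma(x_{1,1},\dots,x_{1,n_1},\dots,x_{r,1},\dots,x_{r,n_r})$, $\gamma=(0^{n_1-\ell(\lambda^{(1)})}*\mathrm{rev}(\lambda^{(1)}))*\cdots*(0^{n_r-\ell(\lambda^{(r)})}*\mathrm{rev}(\lambda^{(r)}))$. The multi-symmetric Kostka coefficients are defined by $\mathcal{S}_{(\lambda)}=\sum_{(\mu)\in\mathrm{Par}^r}K^{(\lambda)}_{(\mu)}m_{\mu^{(1)}}(X_1)\cdots m_{\mu^{(r)}}(X_r)$. -}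

module Defs where

open import Data.Nat using (ℕ; zero; suc; _+_; _≤_; _<_; _>_; pred)
open import Data.Nat.Properties using () renaming (_≟_ to _≟ℕ_)
open import Data.Integer using (ℤ; _-_) renaming (0ℤ to 0ℤ'; 1ℤ to 1ℤ')
open import Data.Fin using (Fin; zero; suc; inject₁)
open import Data.List using (List; []; _∷_)
open import Data.List.Relation.Unary.All using (All)
open import Data.List.Relation.Unary.Linked using (Linked)
open import Data.Vec using (Vec; []; _∷_; lookup; _[_]%=_; replicate; _++_; reverse)
open import Data.Vec.Properties using (≡-dec)
open import Data.Product using (_×_)
open import Data.Unit using (⊤)
open import Relation.Nullary using (yes; no)
open import Relation.Binary.PropositionalEquality using (_≡_)

-- Polynomials (more generally formal power series) in n variables
-- x_1..x_n with integer coefficients, given by their coefficient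
-- function on exponent vectors:  f = Σ_β f(β) x^β.

Poly : ℕ → Set
Poly n = Vec ℕ n → ℤ

mono : ∀ {n} → Vec ℕ n → Poly n
mono α β with ≡-dec _≟ℕ_ β α
... | yes _ = 1ℤ'
... | no  _ = 0ℤ'

mulX : ∀ {n} → Fin n → Poly n → Poly n
mulX p f β with lookup β p
... | zero  = 0ℤ'
... | suc _ = f (β [ p ]%= pred)

swapAdj : ∀ {A : Set} {m} → Fin m → Vec A (suc m) → Vec A (suc m)
swapAdj zero    (a ∷ b ∷ xs) = b ∷ a ∷ xs
swapAdj (suc i) (a ∷ xs)     = a ∷ swapAdj i xs

swapPoly : ∀ {m} → Fin m → Poly (suc m) → Poly (suc m)
swapPoly i f β = f (swapAdj i β)

Decreasing : ∀ {n} → Vec ℕ n → Set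
Decreasing []           = ⊤
Decreasing (a ∷ [])     = ⊤
Decreasing (a ∷ b ∷ xs) = b ≤ a × Decreasing (b ∷ xs)

-- A family K (one polynomial K α for every
-- composition α of every length n) is the family of key polynomials
-- iff
--  * K α = x^α for α weakly decreasing, and
--  * K (s_i α) = ξ_i (K α) whenever α_i > α_{i+1}, where
--    ξ_i f = (x_i f - x_{i+1} s_i f)/(x_i - x_{i+1});  since x_i - x_{i+1}
--    is a non-zero-divisor, g = ξ_i f is equivalent to
--    (x_i - x_{i+1}) g = x_i f - x_{i+1} s_i f  (coefficientwise).

record IsKeyFamily (K : ∀ {n} → Vec ℕ n → Poly n) : Set where
  field
    key-dominant : ∀ {n} (α : Vec ℕ n) → Decreasing α →
                   ∀ β → K α β ≡ mono α β
    key-step     : ∀ {m} (α : Vec ℕ (suc m)) (i : Fin m) →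
                   lookup α (inject₁ i) > lookup α (suc i) →
                   ∀ β → mulX (inject₁ i) (K (swapAdj i α)) β
                         - mulX (suc i) (K (swapAdj i α)) β
                       ≡ mulX (inject₁ i) (K α) β
                         - mulX (suc i) (swapPoly i (K α)) β

IsPartition : List ℕ → Set
IsPartition λ′ = All (λ k → 0 < k) λ′ × Linked (λ a b → b ≤ a) λ′

len : List ℕ → ℕ
len []       = 0
len (_ ∷ xs) = suc (len xs)

-- padRight n λ = (λ_1, …, λ_ℓ, 0, …, 0) of length n  (truncated if ℓ > n;
-- this never matters below since n ≥ ℓ(λ) will be assumed)
padRight : (n : ℕ) → List ℕ → Vec ℕ n
padRight zero    _        = []
padRight (suc n) []       = replicate (suc n) 0
padRight (suc n) (x ∷ xs) = x ∷ padRight n xs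

padRev : (n : ℕ) → List ℕ → Vec ℕ n
padRev n λ′ = reverse (padRight n λ′)

total : ∀ {r} → Vec ℕ r → ℕ
total []       = 0
total (n ∷ ns) = n + total ns

blocks : (f : (n : ℕ) → List ℕ → Vec ℕ n) →
         ∀ {r} → Vec (List ℕ) r → (ns : Vec ℕ r) → Vec ℕ (total ns)
blocks f []         []       = []
blocks f (λ′ ∷ λs)  (n ∷ ns) = f n λ′ ++ blocks f λs ns

gammaVec : ∀ {r} → Vec (List ℕ) r → (ns : Vec ℕ r) → Vec ℕ (total ns)
gammaVec = blocks padRev

-- exponent vector of the monomial x_1^{μ^{(1)}} ⋯ x_r^{μ^{(r)}}, the
-- leading monomial of m_{μ^{(1)}}(X_1)⋯m_{μ^{(r)}}(X_r); the coefficient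
-- of m_{μ^{(1)}}⋯m_{μ^{(r)}} is the coefficient of this monomial.
monoVec : ∀ {r} → Vec (List ℕ) r → (ns : Vec ℕ r) → Vec ℕ (total ns)
monoVec = blocks padRight

-- finite-variable approximation of K^{(λ)}_{(μ)}: the coefficient of
-- x^{μ} in K_γ(x_{1,1..n_1}, …, x_{r,1..n_r})
kostkaApprox : (K : ∀ {n} → Vec ℕ n → Poly n) →
               ∀ {r} → (λs μs : Vec (List ℕ) r) → (ns : Vec ℕ r) → ℤ
kostkaApprox K λs μs ns = K (gammaVec λs ns) (monoVec μs ns)

-- Fix α with α_i > α_{i+1} and restrict the coefficients of K_α and K_{s_i α} to a line in the
-- directions x_i, x_{i+1}.  There K_{s_i α} = ξ_i K_α becomes a two-variable recurrence: the
-- coefficients of K_{s_i α} are symmetric, vanish off the support region of K_α, and agree with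
-- those of K_α at the right end of that region on each antidiagonal.  Induction along descents
-- then shows that K_α is supported on the vectors dominated by α (each sum of k entries is at
-- most some sum of k entries of α; these regions are symmetric and convex along antidiagonals)
-- and that its coefficient at α is 1.  Finally the blockwise decreasing μ is reached from the
-- blockwise reversed γ by swapping ascents at positions where μ descends, and no such swap
-- changes the coefficient at μ, because μ is the right end of the region on its own line.
module Submission where

open import Defs
open import Data.Nat using (ℕ; _≤_)
open import Data.Integer using (ℤ; 1ℤ)
open import Data.List using (List)
open import Data.Vec using (Vec)
open import Data.Vec.Relation.Unary.All using (All)
open import Data.Product using (∃)
open import Relation.Binary.PropositionalEquality using (_≡_)

import Data.Integer.Properties as ℤₚ
import Data.Integer.Tactic.RingSolver as ℤ-Solver
import Data.Nat.Properties as ℕₚ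
import Data.Nat.Tactic.RingSolver as ℕ-Solver
open import Algebra.Properties.CommutativeSemigroup ℕₚ.+-commutativeSemigroup
  using (x∙yz≈y∙xz; x∙yz≈z∙xy)
open import Data.Fin using (Fin; zero; suc; inject₁)
open import Data.Fin.Subset using (Subset; Side; inside; outside; ∣_∣)
open import Data.Integer as ℤ using (_-_; 0ℤ)
open import Data.List using ([]; _∷_)
open import Data.List.Relation.Unary.Linked using (Linked; []; _∷_)
open import Data.Nat as ℕ using (zero; suc; _+_; _*_; _<_; _>_; pred; z≤n)
open import Data.Nat.Induction using (<-wellFounded)
open import Data.Nat.Properties
  using (≤-refl; ≤-reflexive; ≤-trans; ≤-total; <⇒≤; <⇒≱; n≤1+n; m≤n⇒m<n∨m≡n; +-suc; +-comm; +-assoc;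
         +-identityʳ; +-mono-≤; +-monoˡ-≤; +-monoʳ-≤; +-monoˡ-<; +-monoʳ-<; +-cancelˡ-≤; +-cancelʳ-≤)
open import Data.Product using (_×_; _,_; proj₁; proj₂; map₂)
open import Data.Sum using (_⊎_; inj₁; inj₂)
open import Data.Unit using (tt)
open import Data.Vec using ([]; _∷_; lookup; _[_]%=_; replicate; _++_; reverse; _∷ʳ_; sum)
open import Data.Vec.Properties using (≡-dec; reverse-∷)
open import Data.Vec.Relation.Unary.All using ([]; _∷_)
import Data.Vec.Relation.Unary.All as All
open import Data.Vec.Relation.Binary.Pointwise.Inductive using (Pointwise; []; _∷_)
open import Function using (flip)
open import Induction.WellFounded using (Acc; acc)
open import Relation.Binary.Construct.Closure.ReflexiveTransitive using (Star; ε; _◅_; _◅◅_; gmap)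
open import Relation.Binary.PropositionalEquality
  using (_≢_; refl; sym; trans; cong; cong₂; subst; subst₂; module ≡-Reasoning)
open import Relation.Nullary using (¬_; yes; no; contradiction)
open import Relation.Nullary.Decidable using (decidable-stable)

private
  variable
    A : Set
    k m n : ℕ

≤-complement : ∀ {a₁ b₁ a b} → a₁ ≤ a → a₁ + b₁ ≡ a + b → b ≤ b₁
≤-complement {a₁} {b₁} {a} {b} a₁≤a eq =
  +-cancelˡ-≤ a₁ b b₁ (≤-trans (+-monoˡ-≤ b a₁≤a) (≤-reflexive (sym eq)))

setAdj : Fin m → A → A → Vec A (suc m) → Vec A (suc m)
setAdj zero    a b (_ ∷ _ ∷ xs) = a ∷ b ∷ xs
setAdj (suc i) a b (x ∷ xs)     = x ∷ setAdj i a b xs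

setAdj-lookup : ∀ (i : Fin m) (xs : Vec A (suc m)) →
                setAdj i (lookup xs (inject₁ i)) (lookup xs (suc i)) xs ≡ xs
setAdj-lookup zero    (x ∷ y ∷ xs) = refl
setAdj-lookup (suc i) (x ∷ xs)     = cong (x ∷_) (setAdj-lookup i xs)

lookup-setAdjˡ : ∀ (i : Fin m) a b (xs : Vec A (suc m)) → lookup (setAdj i a b xs) (inject₁ i) ≡ a
lookup-setAdjˡ zero    a b (x ∷ y ∷ xs) = refl
lookup-setAdjˡ (suc i) a b (x ∷ xs)     = lookup-setAdjˡ i a b xs

lookup-setAdjʳ : ∀ (i : Fin m) a b (xs : Vec A (suc m)) → lookup (setAdj i a b xs) (suc i) ≡ b
lookup-setAdjʳ zero    a b (x ∷ y ∷ xs) = refl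
lookup-setAdjʳ (suc i) a b (x ∷ xs)     = lookup-setAdjʳ i a b xs

setAdj-predˡ : ∀ (i : Fin m) a b (xs : Vec ℕ (suc m)) →
               setAdj i (suc a) b xs [ inject₁ i ]%= pred ≡ setAdj i a b xs
setAdj-predˡ zero    a b (x ∷ y ∷ xs) = refl
setAdj-predˡ (suc i) a b (x ∷ xs)     = cong (x ∷_) (setAdj-predˡ i a b xs)

setAdj-predʳ : ∀ (i : Fin m) a b (xs : Vec ℕ (suc m)) →
               setAdj i a (suc b) xs [ suc i ]%= pred ≡ setAdj i a b xs
setAdj-predʳ zero    a b (x ∷ y ∷ xs) = refl
setAdj-predʳ (suc i) a b (x ∷ xs)     = cong (x ∷_) (setAdj-predʳ i a b xs)

swapAdj-setAdj : ∀ (i : Fin m) a b (xs : Vec A (suc m)) → swapAdj i (setAdj i a b xs) ≡ setAdj i b a xs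
swapAdj-setAdj zero    a b (x ∷ y ∷ xs) = refl
swapAdj-setAdj (suc i) a b (x ∷ xs)     = cong (x ∷_) (swapAdj-setAdj i a b xs)

swapAdj-involutive : ∀ (i : Fin m) (xs : Vec A (suc m)) → swapAdj i (swapAdj i xs) ≡ xs
swapAdj-involutive zero    (x ∷ y ∷ xs) = refl
swapAdj-involutive (suc i) (x ∷ xs)     = cong (x ∷_) (swapAdj-involutive i xs)

swapAdj-as-setAdj : ∀ (i : Fin m) (xs : Vec A (suc m)) →
                    swapAdj i xs ≡ setAdj i (lookup xs (suc i)) (lookup xs (inject₁ i)) xs
swapAdj-as-setAdj i xs = begin
  swapAdj i xs                                                        ≡⟨ cong (swapAdj i) (sym (setAdj-lookup i xs)) ⟩
  swapAdj i (setAdj i (lookup xs (inject₁ i)) (lookup xs (suc i)) xs) ≡⟨ swapAdj-setAdj i _ _ xs ⟩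
  setAdj i (lookup xs (suc i)) (lookup xs (inject₁ i)) xs             ∎
  where open ≡-Reasoning

lookup-swapAdjˡ : ∀ (i : Fin m) (xs : Vec A (suc m)) → lookup (swapAdj i xs) (inject₁ i) ≡ lookup xs (suc i)
lookup-swapAdjˡ i xs = trans (cong (λ ys → lookup ys (inject₁ i)) (swapAdj-as-setAdj i xs)) (lookup-setAdjˡ i _ _ xs)

lookup-swapAdjʳ : ∀ (i : Fin m) (xs : Vec A (suc m)) → lookup (swapAdj i xs) (suc i) ≡ lookup xs (inject₁ i)
lookup-swapAdjʳ i xs = trans (cong (λ ys → lookup ys (suc i)) (swapAdj-as-setAdj i xs)) (lookup-setAdjʳ i _ _ xs)

swapAdj-identity : ∀ (i : Fin m) (xs : Vec A (suc m)) →
                   lookup xs (inject₁ i) ≡ lookup xs (suc i) → swapAdj i xs ≡ xs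
swapAdj-identity i xs eq = begin
  swapAdj i xs                                            ≡⟨ swapAdj-as-setAdj i xs ⟩
  setAdj i (lookup xs (suc i)) (lookup xs (inject₁ i)) xs ≡⟨ cong₂ (λ a b → setAdj i a b xs) (sym eq) eq ⟩
  setAdj i (lookup xs (inject₁ i)) (lookup xs (suc i)) xs ≡⟨ setAdj-lookup i xs ⟩
  xs                                                      ∎
  where open ≡-Reasoning

mono-refl : ∀ (α : Vec ℕ n) → mono α α ≡ 1ℤ
mono-refl α with ≡-dec ℕₚ._≟_ α α
... | yes _   = refl
... | no α≢α = contradiction refl α≢α

mono-≢ : ∀ (α β : Vec ℕ n) → β ≢ α → mono α β ≡ 0ℤ
mono-≢ α β β≢α with ≡-dec ℕₚ._≟_ β α
... | yes β≡α = contradiction β≡α β≢α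
... | no _    = refl

mulX-zero : ∀ (p : Fin n) (f : Poly n) β → lookup β p ≡ 0 → mulX p f β ≡ 0ℤ
mulX-zero p f β eq with lookup β p
mulX-zero p f β refl | zero = refl

mulX-suc : ∀ (p : Fin n) (f : Poly n) β {k} → lookup β p ≡ suc k → mulX p f β ≡ f (β [ p ]%= pred)
mulX-suc p f β eq with lookup β p
mulX-suc p f β refl | suc _ = refl

line : Fin m → Poly (suc m) → Vec ℕ (suc m) → ℕ → ℕ → ℤ
line i f δ a b = f (setAdj i a b δ)

xMul yMul : (ℕ → ℕ → ℤ) → ℕ → ℕ → ℤ
xMul F zero    b       = 0ℤ
xMul F (suc a) b       = F a b
yMul F a       zero    = 0ℤ
yMul F a       (suc b) = F a b

mulX-lineˡ : ∀ (i : Fin m) f δ a b → mulX (inject₁ i) f (setAdj i a b δ) ≡ xMul (line i f δ) a b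
mulX-lineˡ i f δ zero    b = mulX-zero (inject₁ i) f (setAdj i 0 b δ) (lookup-setAdjˡ i 0 b δ)
mulX-lineˡ i f δ (suc a) b =
  trans (mulX-suc (inject₁ i) f (setAdj i (suc a) b δ) (lookup-setAdjˡ i (suc a) b δ)) (cong f (setAdj-predˡ i a b δ))

mulX-lineʳ : ∀ (i : Fin m) f δ a b → mulX (suc i) f (setAdj i a b δ) ≡ yMul (line i f δ) a b
mulX-lineʳ i f δ a zero    = mulX-zero (suc i) f (setAdj i a 0 δ) (lookup-setAdjʳ i a 0 δ)
mulX-lineʳ i f δ a (suc b) =
  trans (mulX-suc (suc i) f (setAdj i a (suc b) δ) (lookup-setAdjʳ i a (suc b) δ)) (cong f (setAdj-predʳ i a b δ))

yMul-line-swapPoly : ∀ (i : Fin m) f δ a b → yMul (line i (swapPoly i f) δ) a b ≡ yMul (flip (line i f δ)) a b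
yMul-line-swapPoly i f δ a zero    = refl
yMul-line-swapPoly i f δ a (suc b) = cong f (swapAdj-setAdj i a b δ)

-- The Demazure operator on two variables

-- The hypothesis says (x − y) G = x F − y F(y, x), i.e. G = ξ F.
module DemazureLine (G F : ℕ → ℕ → ℤ)
  (demazure : ∀ a b → xMul G a b - yMul G a b ≡ xMul F a b - yMul (flip F) a b) where

  G-edgeˡ : ∀ a → G a 0 ≡ F a 0
  G-edgeˡ a = begin
    G a 0         ≡⟨ sym (ℤₚ.+-identityʳ (G a 0)) ⟩
    G a 0 - 0ℤ    ≡⟨ demazure (suc a) 0 ⟩
    F a 0 - 0ℤ    ≡⟨ ℤₚ.+-identityʳ (F a 0) ⟩
    F a 0         ∎
    where open ≡-Reasoning

  G-edgeʳ : ∀ b → G 0 b ≡ F b 0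
  G-edgeʳ b = ℤₚ.neg-injective (begin
    ℤ.- G 0 b       ≡⟨ sym (ℤₚ.+-identityˡ _) ⟩
    0ℤ - G 0 b      ≡⟨ demazure 0 (suc b) ⟩
    0ℤ - F b 0      ≡⟨ ℤₚ.+-identityˡ _ ⟩
    ℤ.- F b 0       ∎)
    where open ≡-Reasoning

  G-step : ∀ a b → G a (suc b) ≡ G (suc a) b ℤ.+ (F a (suc b) - F b (suc a))
  G-step a b = begin
    G a (suc b)                                   ≡⟨ x≡y+[x-y] (G a (suc b)) (G (suc a) b) ⟩
    G (suc a) b ℤ.+ (G a (suc b) - G (suc a) b)   ≡⟨ cong (λ d → G (suc a) b ℤ.+ d) (demazure (suc a) (suc b)) ⟩
    G (suc a) b ℤ.+ (F a (suc b) - F b (suc a))   ∎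
    where
      open ≡-Reasoning
      x≡y+[x-y] : ∀ x y → x ≡ y ℤ.+ (x - y)
      x≡y+[x-y] = ℤ-Solver.solve-∀

  G-sym : ∀ a b → G a b ≡ G b a
  G-sym a zero    = trans (G-edgeˡ a) (sym (G-edgeʳ a))
  G-sym a (suc b) = begin
    G a (suc b)                                       ≡⟨ G-step a b ⟩
    G (suc a) b ℤ.+ D                                 ≡⟨ cong (ℤ._+ D) (G-sym (suc a) b) ⟩
    G b (suc a) ℤ.+ D                                 ≡⟨ cong (ℤ._+ D) (G-step b a) ⟩
    G (suc b) a ℤ.+ (F b (suc a) - F a (suc b)) ℤ.+ D ≡⟨ cancel (G (suc b) a) (F a (suc b)) (F b (suc a)) ⟩
    G (suc b) a                                       ∎
    where
      open ≡-Reasoning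
      D = F a (suc b) - F b (suc a)
      cancel : ∀ x u v → x ℤ.+ (v - u) ℤ.+ (u - v) ≡ x
      cancel = ℤ-Solver.solve-∀

  module SupportedIn (P : ℕ → ℕ → Set) (P-sym : ∀ {a b} → P a b → P b a)
    (P-interval : ∀ {a₁ b₁ a₂ b₂ a b} → P a₁ b₁ → P a₂ b₂ → a₁ ≤ a → a ≤ a₂ →
                  a₁ + b₁ ≡ a + b → P a b)
    (F-support : ∀ a b → ¬ P a b → F a b ≡ 0ℤ) where

    Vacant : ℕ → ℕ → Set
    Vacant a s = ∀ a′ b′ → a ≤ a′ → a′ + b′ ≡ s → ¬ P a′ b′

    vacant-shift : ∀ a b → Vacant a (a + suc b) → Vacant (suc a) (suc a + b)
    vacant-shift a b v a′ b′ a<a′ eq = v a′ b′ (<⇒≤ a<a′) (trans eq (sym (+-suc a b)))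

    G-vacant : ∀ a b → Vacant a (a + b) → G a b ≡ 0ℤ
    G-vacant a zero    v = trans (G-edgeˡ a) (F-support a 0 (v a 0 ≤-refl refl))
    G-vacant a (suc b) v = begin
      G a (suc b)                                 ≡⟨ G-step a b ⟩
      G (suc a) b ℤ.+ (F a (suc b) - F b (suc a)) ≡⟨ cong₂ ℤ._+_ G₀ (cong₂ _-_ F₀ F₀′) ⟩
      0ℤ                                          ∎
      where
        open ≡-Reasoning
        G₀  = G-vacant (suc a) b (vacant-shift a b v)
        F₀  = F-support a (suc b) (v a (suc b) ≤-refl refl)
        F₀′ = F-support b (suc a) (λ p → v (suc a) b (n≤1+n a) (sym (+-suc a b)) (P-sym p))

    G≡F : ∀ a b → Vacant (suc a) (a + b) → G a b ≡ F a b
    G≡F a zero    v = G-edgeˡ a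
    G≡F a (suc b) v = begin
      G a (suc b)                                 ≡⟨ G-step a b ⟩
      G (suc a) b ℤ.+ (F a (suc b) - F b (suc a)) ≡⟨ cong₂ (λ x y → x ℤ.+ (F a (suc b) - y)) G₀ F₀ ⟩
      0ℤ ℤ.+ (F a (suc b) - 0ℤ)                   ≡⟨ ℤₚ.+-identityˡ _ ⟩
      F a (suc b) - 0ℤ                            ≡⟨ ℤₚ.+-identityʳ _ ⟩
      F a (suc b)                                 ∎
      where
        open ≡-Reasoning
        v′ = subst (Vacant (suc a)) (+-suc a b) v
        G₀ = G-vacant (suc a) b v′
        F₀ = F-support b (suc a) (λ p → v′ (suc a) b ≤-refl refl (P-sym p))

    -- Since P misses (a, b) it misses one whole side of the antidiagonal through it.  Which
    -- side is not decidable, but the conclusion is, so we may argue by contradiction.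
    G-support : ∀ a b → ¬ P a b → G a b ≡ 0ℤ
    G-support a b ¬P = decidable-stable (G a b ℤₚ.≟ 0ℤ) λ G≢0 →
      G≢0 (G-vacant a b λ a₂ b₂ a≤a₂ _ P₂ →
      G≢0 (trans (G-sym a b) (G-vacant b a λ a₁ b₁ b≤a₁ eq₁ P₁ →
      ¬P (P-interval (P-sym P₁) P₂ (≤-complement b≤a₁ (sym eq₁)) a≤a₂
                     (trans (+-comm b₁ a₁) (trans eq₁ (+-comm b a)))))))

-- Dominance of exponent vectors

weight : Side → ℕ → ℕ
weight inside  x = x
weight outside x = 0

sumOver : Subset n → Vec ℕ n → ℕ
sumOver []      []       = 0
sumOver (s ∷ T) (x ∷ xs) = weight s x + sumOver T xs

infix 4 _⊴_
_⊴_ : Vec ℕ n → Vec ℕ n → Set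
δ ⊴ α = ∀ T → ∃ λ T′ → ∣ T′ ∣ ≡ ∣ T ∣ × sumOver T δ ≤ sumOver T′ α

⊴-refl : ∀ (α : Vec ℕ n) → α ⊴ α
⊴-refl α T = T , refl , ≤-refl

∣swapAdj∣ : ∀ (i : Fin m) (T : Subset (suc m)) → ∣ swapAdj i T ∣ ≡ ∣ T ∣
∣swapAdj∣ zero    (inside  ∷ inside  ∷ T) = refl
∣swapAdj∣ zero    (inside  ∷ outside ∷ T) = refl
∣swapAdj∣ zero    (outside ∷ inside  ∷ T) = refl
∣swapAdj∣ zero    (outside ∷ outside ∷ T) = refl
∣swapAdj∣ (suc i) (inside  ∷ T)           = cong suc (∣swapAdj∣ i T)
∣swapAdj∣ (suc i) (outside ∷ T)           = ∣swapAdj∣ i T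

sumOver-swapAdj : ∀ (i : Fin m) T (xs : Vec ℕ (suc m)) → sumOver (swapAdj i T) (swapAdj i xs) ≡ sumOver T xs
sumOver-swapAdj zero    (s ∷ t ∷ T) (x ∷ y ∷ xs) = x∙yz≈y∙xz (weight t y) (weight s x) (sumOver T xs)
sumOver-swapAdj (suc i) (s ∷ T)     (x ∷ xs)     = cong (weight s x +_) (sumOver-swapAdj i T xs)

⊴-swapAdjˡ : ∀ (i : Fin m) {δ α : Vec ℕ (suc m)} → δ ⊴ α → swapAdj i δ ⊴ α
⊴-swapAdjˡ i {δ} δ⊴α T with δ⊴α (swapAdj i T)
... | T′ , c , le = T′ , trans c (∣swapAdj∣ i T) , ≤-trans (≤-reflexive moved) le
  where
    moved : sumOver T (swapAdj i δ) ≡ sumOver (swapAdj i T) δ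
    moved = begin
      sumOver T (swapAdj i δ)                         ≡⟨ cong (λ U → sumOver U (swapAdj i δ)) (sym (swapAdj-involutive i T)) ⟩
      sumOver (swapAdj i (swapAdj i T)) (swapAdj i δ) ≡⟨ sumOver-swapAdj i (swapAdj i T) δ ⟩
      sumOver (swapAdj i T) δ                         ∎
      where open ≡-Reasoning

⊴-swapAdjʳ : ∀ (i : Fin m) {δ α : Vec ℕ (suc m)} → δ ⊴ α → δ ⊴ swapAdj i α
⊴-swapAdjʳ i {δ} {α} δ⊴α T with δ⊴α T
... | T′ , c , le = swapAdj i T′ , trans (∣swapAdj∣ i T′) c , ≤-trans le (≤-reflexive (sym (sumOver-swapAdj i T′ α)))

weight-zero : ∀ s → weight s 0 ≡ 0
weight-zero inside  = refl
weight-zero outside = refl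

sumOver-setAdj : ∀ (i : Fin m) T a b (δ : Vec ℕ (suc m)) →
                 sumOver T (setAdj i a b δ) ≡
                 sumOver T (setAdj i 0 0 δ) + (weight (lookup T (inject₁ i)) a + weight (lookup T (suc i)) b)
sumOver-setAdj zero (s ∷ t ∷ T) a b (x ∷ y ∷ δ)
  rewrite weight-zero s | weight-zero t = x∙yz≈z∙xy (weight s a) (weight t b) (sumOver T δ)
sumOver-setAdj (suc i) (s ∷ T) a b (x ∷ δ) =
  trans (cong (weight s x +_) (sumOver-setAdj i T a b δ)) (sym (+-assoc (weight s x) _ _))

sumOver-setAdj-mono : ∀ (i : Fin m) T {a b a′ b′} (δ : Vec ℕ (suc m)) →
  weight (lookup T (inject₁ i)) a + weight (lookup T (suc i)) b ≤
  weight (lookup T (inject₁ i)) a′ + weight (lookup T (suc i)) b′ →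
  sumOver T (setAdj i a b δ) ≤ sumOver T (setAdj i a′ b′ δ)
sumOver-setAdj-mono i T {a} {b} {a′} {b′} δ le = begin
  sumOver T (setAdj i a b δ)     ≡⟨ sumOver-setAdj i T a b δ ⟩
  sumOver T (setAdj i 0 0 δ) + _ ≤⟨ +-monoʳ-≤ (sumOver T (setAdj i 0 0 δ)) le ⟩
  sumOver T (setAdj i 0 0 δ) + _ ≡⟨ sym (sumOver-setAdj i T a′ b′ δ) ⟩
  sumOver T (setAdj i a′ b′ δ)   ∎
  where open ℕₚ.≤-Reasoning

weight-interval : ∀ s t {a₁ b₁ a₂ b₂ a b} → a₁ ≤ a → a ≤ a₂ → a₁ + b₁ ≡ a + b →
                  weight s a + weight t b ≤ weight s a₁ + weight t b₁ ⊎
                  weight s a + weight t b ≤ weight s a₂ + weight t b₂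
weight-interval inside  inside  a₁≤a a≤a₂ eq = inj₁ (≤-reflexive (sym eq))
weight-interval inside  outside a₁≤a a≤a₂ eq = inj₂ (+-monoˡ-≤ 0 a≤a₂)
weight-interval outside inside  a₁≤a a≤a₂ eq = inj₁ (≤-complement a₁≤a eq)
weight-interval outside outside a₁≤a a≤a₂ eq = inj₁ z≤n

⊴-interval : ∀ (i : Fin m) {α δ : Vec ℕ (suc m)} {a₁ b₁ a₂ b₂ a b} →
             setAdj i a₁ b₁ δ ⊴ α → setAdj i a₂ b₂ δ ⊴ α → a₁ ≤ a → a ≤ a₂ →
             a₁ + b₁ ≡ a + b → setAdj i a b δ ⊴ α
⊴-interval i {δ = δ} p₁ p₂ a₁≤a a≤a₂ eq T
  with weight-interval (lookup T (inject₁ i)) (lookup T (suc i)) a₁≤a a≤a₂ eq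
... | inj₁ le = map₂ (map₂ (≤-trans (sumOver-setAdj-mono i T δ le))) (p₁ T)
... | inj₂ le = map₂ (map₂ (≤-trans (sumOver-setAdj-mono i T δ le))) (p₂ T)

AtThreshold : ℕ → Side → ℕ → Set
AtThreshold c inside  x = c ≤ x
AtThreshold c outside x = x ≤ c

threshold : ∀ c (xs : Vec ℕ n) → ∃ λ (U : Subset n) → Pointwise (AtThreshold c) U xs
threshold c []       = [] , []
threshold c (x ∷ xs) with ≤-total c x | threshold c xs
... | inj₁ c≤x | U , t = inside  ∷ U , c≤x ∷ t
... | inj₂ x≤c | U , t = outside ∷ U , x≤c ∷ t

threshold-setAdj : ∀ (i : Fin m) {c U} {xs : Vec ℕ (suc m)} → Pointwise (AtThreshold c) U xs →
                   c ≤ lookup xs (inject₁ i) → lookup xs (suc i) ≤ c →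
                   Pointwise (AtThreshold c) (setAdj i inside outside U) xs
threshold-setAdj zero    (_ ∷ _ ∷ t) c≤x y≤c = c≤x ∷ y≤c ∷ t
threshold-setAdj (suc i) (h ∷ t)     c≤x y≤c = h ∷ threshold-setAdj i t c≤x y≤c

private
  shift-suc : ∀ s c k → s + c * suc k ≡ c + (s + c * k)
  shift-suc = ℕ-Solver.solve-∀

  shift-suc₂ : ∀ x s c k → x + s + c * suc k ≡ x + c + (s + c * k)
  shift-suc₂ = ℕ-Solver.solve-∀

-- U maximises Σ_{j ∈ T} (β_j − c) over all T; stated with both sides moved to avoid subtraction.
sumOver-threshold : ∀ {c} {U : Subset n} {β} → Pointwise (AtThreshold c) U β →
                    ∀ T → sumOver T β + c * ∣ U ∣ ≤ sumOver U β + c * ∣ T ∣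
sumOver-threshold [] [] = ≤-refl
sumOver-threshold {c = c} {inside ∷ U} {x ∷ β} (c≤x ∷ t) (inside ∷ T) = begin
  x + sumOver T β + c * suc ∣ U ∣   ≡⟨ shift-suc₂ x (sumOver T β) c ∣ U ∣ ⟩
  x + c + (sumOver T β + c * ∣ U ∣) ≤⟨ +-monoʳ-≤ (x + c) (sumOver-threshold t T) ⟩
  x + c + (sumOver U β + c * ∣ T ∣) ≡⟨ sym (shift-suc₂ x (sumOver U β) c ∣ T ∣) ⟩
  x + sumOver U β + c * suc ∣ T ∣   ∎
  where open ℕₚ.≤-Reasoning
sumOver-threshold {c = c} {inside ∷ U} {x ∷ β} (c≤x ∷ t) (outside ∷ T) = begin
  sumOver T β + c * suc ∣ U ∣     ≡⟨ shift-suc (sumOver T β) c ∣ U ∣ ⟩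
  c + (sumOver T β + c * ∣ U ∣)   ≤⟨ +-mono-≤ c≤x (sumOver-threshold t T) ⟩
  x + (sumOver U β + c * ∣ T ∣)   ≡⟨ sym (+-assoc x _ _) ⟩
  x + sumOver U β + c * ∣ T ∣     ∎
  where open ℕₚ.≤-Reasoning
sumOver-threshold {c = c} {outside ∷ U} {x ∷ β} (x≤c ∷ t) (inside ∷ T) = begin
  x + sumOver T β + c * ∣ U ∣     ≡⟨ +-assoc x _ _ ⟩
  x + (sumOver T β + c * ∣ U ∣)   ≤⟨ +-mono-≤ x≤c (sumOver-threshold t T) ⟩
  c + (sumOver U β + c * ∣ T ∣)   ≡⟨ sym (shift-suc (sumOver U β) c ∣ T ∣) ⟩
  sumOver U β + c * suc ∣ T ∣     ∎
  where open ℕₚ.≤-Reasoning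
sumOver-threshold {U = outside ∷ U} (x≤c ∷ t) (outside ∷ T) = sumOver-threshold t T

sumOver-threshold-max : ∀ {c} {U : Subset n} {β} → Pointwise (AtThreshold c) U β →
                        ∀ T → ∣ T ∣ ≡ ∣ U ∣ → sumOver T β ≤ sumOver U β
sumOver-threshold-max {c = c} {U} {β} t T eq = +-cancelʳ-≤ (c * ∣ U ∣) _ _ (begin
  sumOver T β + c * ∣ U ∣ ≤⟨ sumOver-threshold t T ⟩
  sumOver U β + c * ∣ T ∣ ≡⟨ cong (λ k → sumOver U β + c * k) eq ⟩
  sumOver U β + c * ∣ U ∣ ∎)
  where open ℕₚ.≤-Reasoning

-- Witnessed by the threshold set of β at c = β_i, adjusted to contain i but not i + 1.
setAdj-raise-⋬ : ∀ (i : Fin m) {β : Vec ℕ (suc m)} {q r} →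
                 lookup β (suc i) ≤ lookup β (inject₁ i) → lookup β (inject₁ i) < q →
                 ¬ setAdj i q r β ⊴ β
setAdj-raise-⋬ i {β} {q} {r} y≤c c<q raised⊴β = <⇒≱ c<q (+-cancelˡ-≤ C q c (begin
  C + q                                       ≡⟨ sym (sum-at q r) ⟩
  sumOver U (setAdj i q r β)                  ≤⟨ proj₂ (proj₂ (raised⊴β U)) ⟩
  sumOver T′ β                                ≤⟨ sumOver-threshold-max tU T′ (proj₁ (proj₂ (raised⊴β U))) ⟩
  sumOver U β                                 ≡⟨ cong (sumOver U) (sym (setAdj-lookup i β)) ⟩
  sumOver U (setAdj i c (lookup β (suc i)) β) ≡⟨ sum-at c _ ⟩
  C + c                                       ∎))
  where
    open ℕₚ.≤-Reasoning
    c = lookup β (inject₁ i)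
    U₀ = proj₁ (threshold c β)
    U = setAdj i inside outside U₀
    tU : Pointwise (AtThreshold c) U β
    tU = threshold-setAdj i (proj₂ (threshold c β)) ≤-refl y≤c
    T′ = proj₁ (raised⊴β U)
    C = sumOver U (setAdj i 0 0 β)
    sum-at : ∀ a b → sumOver U (setAdj i a b β) ≡ C + a
    sum-at a b = trans (sumOver-setAdj i U a b β)
      (trans (cong₂ (λ s t → C + (weight s a + weight t b))
                    (lookup-setAdjˡ i inside outside U₀) (lookup-setAdjʳ i inside outside U₀))
             (cong (C +_) (+-identityʳ a)))

-- Induction over descents

positionWeight : Vec ℕ n → ℕ
positionWeight []       = 0
positionWeight (x ∷ xs) = sum xs + positionWeight xs

sum-swapAdj : ∀ (i : Fin m) (xs : Vec ℕ (suc m)) → sum (swapAdj i xs) ≡ sum xs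
sum-swapAdj zero    (x ∷ y ∷ xs) = x∙yz≈y∙xz y x (sum xs)
sum-swapAdj (suc i) (x ∷ xs)     = cong (x +_) (sum-swapAdj i xs)

positionWeight-swapAdj : ∀ (i : Fin m) (xs : Vec ℕ (suc m)) → lookup xs (inject₁ i) < lookup xs (suc i) →
                         positionWeight (swapAdj i xs) < positionWeight xs
positionWeight-swapAdj zero    (x ∷ y ∷ xs) x<y = +-monoˡ-< _ (+-monoˡ-< (sum xs) x<y)
positionWeight-swapAdj (suc i) (x ∷ xs)     lt  = begin-strict
  sum (swapAdj i xs) + positionWeight (swapAdj i xs) ≡⟨ cong (_+ positionWeight (swapAdj i xs)) (sum-swapAdj i xs) ⟩
  sum xs + positionWeight (swapAdj i xs)             <⟨ +-monoʳ-< (sum xs) (positionWeight-swapAdj i xs lt) ⟩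
  sum xs + positionWeight xs                         ∎
  where open ℕₚ.≤-Reasoning

decreasing-or-ascent : ∀ (α : Vec ℕ (suc m)) →
                       Decreasing α ⊎ ∃ λ (i : Fin m) → lookup α (inject₁ i) < lookup α (suc i)
decreasing-or-ascent (x ∷ [])     = inj₁ tt
decreasing-or-ascent (x ∷ y ∷ xs) with y ℕ.≤? x
... | no y≰x = inj₂ (zero , ℕₚ.≰⇒> y≰x)
... | yes y≤x with decreasing-or-ascent (y ∷ xs)
...   | inj₁ dec      = inj₁ (y≤x , dec)
...   | inj₂ (i , lt) = inj₂ (suc i , lt)

descent-induction : (P : ∀ {n} → Vec ℕ n → Set) →
  (∀ {n} (α : Vec ℕ n) → Decreasing α → P α) →
  (∀ {m} (α : Vec ℕ (suc m)) (i : Fin m) → lookup α (inject₁ i) > lookup α (suc i) → P α → P (swapAdj i α)) →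
  ∀ {n} (α : Vec ℕ n) → P α
descent-induction P base step []      = base [] tt
descent-induction P base step (x ∷ α) = go (x ∷ α) (<-wellFounded _)
  where
    go : ∀ {m} (α : Vec ℕ (suc m)) → Acc _<_ (positionWeight α) → P α
    go α (acc rec) with decreasing-or-ascent α
    ... | inj₁ dec      = base α dec
    ... | inj₂ (i , lt) = subst P (swapAdj-involutive i α)
      (step (swapAdj i α) i
            (subst₂ _<_ (sym (lookup-swapAdjʳ i α)) (sym (lookup-swapAdjˡ i α)) lt)
            (go (swapAdj i α) (rec (positionWeight-swapAdj i α lt))))

data AscentSwap : Vec ℕ n → Vec ℕ n → Vec ℕ n → Set where
  here  : ∀ {a b c d} {β α : Vec ℕ n} → a ≤ b → d ≤ c → AscentSwap (c ∷ d ∷ β) (a ∷ b ∷ α) (b ∷ a ∷ α)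
  there : ∀ {x y} {β α α′ : Vec ℕ n} → AscentSwap β α α′ → AscentSwap (x ∷ β) (y ∷ α) (y ∷ α′)

AscentSwap-position : ∀ {β α α′ : Vec ℕ (suc m)} → AscentSwap β α α′ →
  ∃ λ i → lookup α (inject₁ i) ≤ lookup α (suc i) × lookup β (suc i) ≤ lookup β (inject₁ i) × α′ ≡ swapAdj i α
AscentSwap-position (here a≤b d≤c) = zero , a≤b , d≤c , refl
AscentSwap-position {m = suc m} (there s) with AscentSwap-position s
... | i , a≤b , d≤c , eq = suc i , a≤b , d≤c , cong (_ ∷_) eq

⊴-ascentSwap : ∀ {β α α′ δ : Vec ℕ n} → AscentSwap β α α′ → δ ⊴ α → δ ⊴ α′
⊴-ascentSwap {n = suc m} s δ⊴α with AscentSwap-position s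
... | i , _ , _ , refl = ⊴-swapAdjʳ i δ⊴α

⊴-along : ∀ {β α γ δ : Vec ℕ n} → Star (AscentSwap β) α γ → δ ⊴ α → δ ⊴ γ
⊴-along ε        δ⊴α = δ⊴α
⊴-along (s ◅ ss) δ⊴α = ⊴-along ss (⊴-ascentSwap s δ⊴α)

module KeyPolynomials (K : ∀ {n} → Vec ℕ n → Poly n) (isKey : IsKeyFamily K) where
  open IsKeyFamily isKey

  Supported : Vec ℕ n → Set
  Supported α = ∀ δ → ¬ δ ⊴ α → K α δ ≡ 0ℤ

  dominant-supported : ∀ (α : Vec ℕ n) → Decreasing α → Supported α
  dominant-supported α dec δ δ⋬α =
    trans (key-dominant α dec δ) (mono-≢ α δ λ δ≡α → δ⋬α (subst (_⊴ α) (sym δ≡α) (⊴-refl α)))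

  key-line-demazure : ∀ {α : Vec ℕ (suc m)} {i} → lookup α (inject₁ i) > lookup α (suc i) → ∀ δ a b →
    xMul (line i (K (swapAdj i α)) δ) a b - yMul (line i (K (swapAdj i α)) δ) a b ≡
    xMul (line i (K α) δ) a b - yMul (flip (line i (K α) δ)) a b
  key-line-demazure {α = α} {i} desc δ a b = begin
    xMul (line i g δ) a b - yMul (line i g δ) a b                         ≡⟨ sym (cong₂ _-_ (mulX-lineˡ i g δ a b) (mulX-lineʳ i g δ a b)) ⟩
    mulX (inject₁ i) g (setAdj i a b δ) - mulX (suc i) g (setAdj i a b δ) ≡⟨ key-step α i desc (setAdj i a b δ) ⟩
    mulX (inject₁ i) f (setAdj i a b δ) - mulX (suc i) (swapPoly i f) (setAdj i a b δ)
      ≡⟨ cong₂ _-_ (mulX-lineˡ i f δ a b) (trans (mulX-lineʳ i (swapPoly i f) δ a b) (yMul-line-swapPoly i f δ a b)) ⟩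
    xMul (line i f δ) a b - yMul (flip (line i f δ)) a b                  ∎
    where
      open ≡-Reasoning
      f = K α
      g = K (swapAdj i α)

  module Descent {α : Vec ℕ (suc m)} {i : Fin m} (desc : lookup α (inject₁ i) > lookup α (suc i)) where
    private
      g = K (swapAdj i α)
      module Line δ = DemazureLine (line i g δ) (line i (K α) δ) (key-line-demazure desc δ)
      module Region (sup : Supported α) δ = Line.SupportedIn δ (λ a b → setAdj i a b δ ⊴ α)
        (λ {a} {b} p → subst (_⊴ α) (swapAdj-setAdj i a b δ) (⊴-swapAdjˡ i p))
        (⊴-interval i)
        (λ a b → sup (setAdj i a b δ))

    key-swap-symmetric : ∀ δ → K (swapAdj i α) (swapAdj i δ) ≡ K (swapAdj i α) δ
    key-swap-symmetric δ = begin
      g (swapAdj i δ)                                          ≡⟨ cong g (swapAdj-as-setAdj i δ) ⟩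
      line i g δ (lookup δ (suc i)) (lookup δ (inject₁ i))     ≡⟨ Line.G-sym δ _ _ ⟩
      line i g δ (lookup δ (inject₁ i)) (lookup δ (suc i))     ≡⟨ cong g (setAdj-lookup i δ) ⟩
      g δ                                                      ∎
      where open ≡-Reasoning

    key-swap-supported : Supported α → Supported (swapAdj i α)
    key-swap-supported sup δ δ⋬sα = begin
      g δ                                                  ≡⟨ cong g (sym (setAdj-lookup i δ)) ⟩
      line i g δ (lookup δ (inject₁ i)) (lookup δ (suc i)) ≡⟨ Region.G-support sup δ _ _ off-region ⟩
      0ℤ                                                   ∎
      where
        open ≡-Reasoning
        off-region : ¬ setAdj i (lookup δ (inject₁ i)) (lookup δ (suc i)) δ ⊴ α
        off-region p = δ⋬sα (⊴-swapAdjʳ i (subst (_⊴ α) (setAdj-lookup i δ) p))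

    key-swap-coefficient : Supported α → ∀ β →
      (∀ q r → lookup β (inject₁ i) < q → ¬ setAdj i q r β ⊴ α) → K (swapAdj i α) β ≡ K α β
    key-swap-coefficient sup β right-vacant = begin
      g β                                                      ≡⟨ cong g (sym (setAdj-lookup i β)) ⟩
      line i g β (lookup β (inject₁ i)) (lookup β (suc i))     ≡⟨ Region.G≡F sup β _ _ (λ q r lt _ → right-vacant q r lt) ⟩
      line i (K α) β (lookup β (inject₁ i)) (lookup β (suc i)) ≡⟨ cong (K α) (setAdj-lookup i β) ⟩
      K α β                                                    ∎
      where open ≡-Reasoning

  open Descent

  key-support : ∀ (α : Vec ℕ n) → Supported α
  key-support = descent-induction Supported dominant-supported (λ α i desc → key-swap-supported desc)

  key-diagonal : ∀ (α : Vec ℕ n) → K α α ≡ 1ℤ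
  key-diagonal = descent-induction (λ α → K α α ≡ 1ℤ)
    (λ α dec → trans (key-dominant α dec α) (mono-refl α))
    (λ α i desc Kαα≡1 → begin
      K (swapAdj i α) (swapAdj i α) ≡⟨ key-swap-symmetric desc α ⟩
      K (swapAdj i α) α             ≡⟨ key-swap-coefficient desc (key-support α) α (λ q r → setAdj-raise-⋬ i (<⇒≤ desc)) ⟩
      K α α                         ≡⟨ Kαα≡1 ⟩
      1ℤ                            ∎)
    where open ≡-Reasoning

  key-ascentSwap : ∀ {β α α′ : Vec ℕ n} → AscentSwap β α α′ → (∀ {δ} → δ ⊴ α′ → δ ⊴ β) → K α β ≡ K α′ β
  key-ascentSwap {n = suc m} {β} {α} s α′⊆β with AscentSwap-position s
  ... | i , asc , descβ , refl with m≤n⇒m<n∨m≡n asc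
  ...   | inj₂ eq = cong (λ γ → K γ β) (sym (swapAdj-identity i α eq))
  ...   | inj₁ lt = begin
    K α β                         ≡⟨ cong (λ γ → K γ β) (sym (swapAdj-involutive i α)) ⟩
    K (swapAdj i (swapAdj i α)) β ≡⟨ key-swap-coefficient desc (key-support _) β right-vacant ⟩
    K (swapAdj i α) β             ∎
    where
      open ≡-Reasoning
      desc = subst₂ _<_ (sym (lookup-swapAdjʳ i α)) (sym (lookup-swapAdjˡ i α)) lt
      right-vacant : ∀ q r → lookup β (inject₁ i) < q → ¬ setAdj i q r β ⊴ swapAdj i α
      right-vacant q r lt′ p = setAdj-raise-⋬ i descβ lt′ (α′⊆β p)

  key-along : ∀ {β α : Vec ℕ n} → Star (AscentSwap β) α β → K α β ≡ K β β
  key-along ε        = refl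
  key-along (s ◅ ss) = trans (key-ascentSwap s (⊴-along ss)) (key-along ss)

-- Sorting the reversed blocks

path-++ˡ : ∀ (p q : Vec ℕ k) {β α γ : Vec ℕ n} →
           Star (AscentSwap β) α γ → Star (AscentSwap (p ++ β)) (q ++ α) (q ++ γ)
path-++ˡ p q = gmap (q ++_) (swap-++ˡ p q)
  where
    swap-++ˡ : ∀ (p q : Vec ℕ k) {β α α′ : Vec ℕ n} →
               AscentSwap β α α′ → AscentSwap (p ++ β) (q ++ α) (q ++ α′)
    swap-++ˡ []      []      s = s
    swap-++ˡ (x ∷ p) (y ∷ q) s = there (swap-++ˡ p q s)

path-++ʳ : ∀ (p q : Vec ℕ k) {β α γ : Vec ℕ n} →
           Star (AscentSwap β) α γ → Star (AscentSwap (β ++ p)) (α ++ q) (γ ++ q)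
path-++ʳ p q = gmap (_++ q) swap-++ʳ
  where
    swap-++ʳ : ∀ {β α α′ : Vec ℕ n} → AscentSwap β α α′ → AscentSwap (β ++ p) (α ++ q) (α′ ++ q)
    swap-++ʳ (here a≤b d≤c) = here a≤b d≤c
    swap-++ʳ (there s)      = there (swap-++ʳ s)

All-∷ʳ : ∀ {P : A → Set} {x} {xs : Vec A n} → All P xs → P x → All P (xs ∷ʳ x)
All-∷ʳ []         px = px ∷ []
All-∷ʳ (py ∷ pys) px = py ∷ All-∷ʳ pys px

All-reverse : ∀ {P : A → Set} {xs : Vec A n} → All P xs → All P (reverse xs)
All-reverse                  []         = []
All-reverse {P = P} {x ∷ xs} (px ∷ pxs) =
  subst (All P) (sym (reverse-∷ x xs)) (All-∷ʳ (All-reverse pxs) px)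

Decreasing-tail : ∀ {x} {xs : Vec ℕ n} → Decreasing (x ∷ xs) → Decreasing xs
Decreasing-tail {xs = []}    _         = tt
Decreasing-tail {xs = _ ∷ _} (_ , dec) = dec

Decreasing-≤head : ∀ {x} {xs : Vec ℕ n} → Decreasing (x ∷ xs) → All (_≤ x) xs
Decreasing-≤head {xs = []}    _           = []
Decreasing-≤head {xs = _ ∷ _} (y≤x , dec) = y≤x ∷ All.map (λ z≤y → ≤-trans z≤y y≤x) (Decreasing-≤head dec)

bubble : ∀ {x} {w : Vec ℕ k} {β} → All (_≤ x) w → Decreasing β → Star (AscentSwap β) (w ∷ʳ x) (x ∷ w)
bubble {w = []}                []          _           = ε
bubble {w = y ∷ w} {c ∷ d ∷ β} (y≤x ∷ w≤x) (d≤c , dec) =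
  path-++ˡ (c ∷ []) (y ∷ []) (bubble w≤x dec) ◅◅ (here y≤x d≤c ◅ ε)

reverse-path : ∀ (β : Vec ℕ n) → Decreasing β → Star (AscentSwap β) (reverse β) β
reverse-path []      _   = ε
reverse-path (x ∷ β) dec = subst (λ γ → Star (AscentSwap (x ∷ β)) γ (x ∷ β)) (sym (reverse-∷ x β))
  (bubble (All-reverse (Decreasing-≤head dec)) dec ◅◅
   path-++ˡ (x ∷ []) (x ∷ []) (reverse-path β (Decreasing-tail dec)))

Decreasing-replicate : ∀ n → Decreasing (replicate n 0)
Decreasing-replicate zero          = tt
Decreasing-replicate (suc zero)    = tt
Decreasing-replicate (suc (suc n)) = z≤n , Decreasing-replicate (suc n)

Decreasing-padRight : ∀ n {λ′} → Linked (λ a b → b ≤ a) λ′ → Decreasing (padRight n λ′)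
Decreasing-padRight zero                        _         = tt
Decreasing-padRight (suc n)       {[]}          _         = Decreasing-replicate (suc n)
Decreasing-padRight (suc zero)    {_ ∷ _}       _         = tt
Decreasing-padRight (suc (suc n)) {_ ∷ []}      _         = z≤n , Decreasing-replicate (suc n)
Decreasing-padRight (suc (suc n)) {_ ∷ _ ∷ _}   (y≤x ∷ l) = y≤x , Decreasing-padRight (suc n) l

blocks-path : ∀ {r} (λs : Vec (List ℕ) r) (ns : Vec ℕ r) → All IsPartition λs →
              Star (AscentSwap (monoVec λs ns)) (gammaVec λs ns) (monoVec λs ns)
blocks-path []        []       []       = ε
blocks-path (λ′ ∷ λs) (n ∷ ns) (p ∷ ps) =
  path-++ʳ (monoVec λs ns) (gammaVec λs ns) (reverse-path (padRight n λ′) (Decreasing-padRight n (proj₂ p)))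
  ◅◅ path-++ˡ (padRight n λ′) (padRight n λ′) (blocks-path λs ns ps)

mainTheorem15 : (K : ∀ {n} → Vec ℕ n → Poly n) → IsKeyFamily K →
                ∀ {r} (λs : Vec (List ℕ) r) → All IsPartition λs →
                ∃ λ N → ∀ (ns : Vec ℕ r) → All (N ≤_) ns →
                  kostkaApprox K λs λs ns ≡ 1ℤ
-- N = 0 works: the argument applies to every block size, truncated partitions included.
mainTheorem15 K isKey λs partitions = 0 , λ ns _ →
  trans (key-along (blocks-path λs ns partitions)) (key-diagonal (monoVec λs ns))
  where open KeyPolynomials K isKey
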